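{- Let $H:\mathbf{Pos}\to\mathbf{Pos}$ be a locally order-preserving functor and let $\alpha:HA\to A$ be an $H$-algebra whose carrier $A$ is a complete lattice. Then $(A,\alpha,(-)^\dagger)$ is a complete Elgot algebra, where $(-)^\dagger$ assigns to every flat equation morphism $e$ in $A$ its least solution (least in the pointwise order of $\mathbf{Pos}(X,A)$).
   Context: $\mathbf{Pos}$ is the category of posets and order-preserving maps; coproducts are disjoint unions, injections $\mathrm{inl},\mathrm{inr}$. $H$ is locally order-preserving if $f\sqsubseteq g$ (pointwise) implies $Hf\sqsubseteq Hg$. A flat equation morphism in $A$ is a morphism $e:X\to HX+A$; a solution is $e^\dagger:X\to A$ with $e^\dagger=[\alpha,\mathrm{id}_A]\cdot(He^\dagger+\mathrm{id}_A)\cdot e$. For $e:X\to HX+Y$ and $h:Y\to Z$, $h\bullet e:=(\mathrm{id}_{HX}+h)\cdot e$; for $e:X\to HX+Y$, $f:Y\to HY+A$, $f\oplus e:=(\mathrm{can}+\mathrm{id}_A)\cdot(\mathrm{id}_{HX}+f)\cdot[e,\mathrm{inr}]:X+Y\to H(X+Y)+A$ with $\mathrm{can}=[H\mathrm{inl},H\mathrm{inr}]$. A complete Elgot algebra is an $H$-algebra with an assignment $e\mapsto e^\dagger$ of a solution to every flat equation morphism that is functorial ($e^\dagger=f^\dagger\cdot h$ whenever $e:X\to HX+A$, $f:Y\to HY+A$, $h:X\to Y$ satisfy $(Hh+\mathrm{id}_A)\cdot e=f\cdot h$) and compositional ($(f^\dagger\bullet e)^\dagger=(f\oplus e)^\dagger\cdot\mathrm{inl}$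 for all $e:X\to HX+Y$, $f:Y\to HY+A$). -}

module Defs where

open import Level using (Level; suc; _⊔_)
open import Data.Product using (Σ; Σ-syntax; _×_; _,_)
open import Data.Sum using (_⊎_; inj₁; inj₂)
import Data.Sum.Relation.Binary.Pointwise as PW
open import Relation.Binary.Bundles using (Poset)
open import Relation.Binary.Morphism.Bundles using (PosetHomomorphism; mkPosetHomo)

Obj : (ℓ : Level) → Set (suc ℓ)
Obj ℓ = Poset ℓ ℓ ℓ

module _ {ℓ : Level} where

  ∣_∣ : Obj ℓ → Set ℓ
  ∣ P ∣ = Poset.Carrier P

  Hom : Obj ℓ → Obj ℓ → Set ℓ
  Hom P Q = PosetHomomorphism P Q

  app : {P Q : Obj ℓ} → Hom P Q → ∣ P ∣ → ∣ Q ∣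
  app f = PosetHomomorphism.⟦_⟧ f

  _≐_ : {P Q : Obj ℓ} → Hom P Q → Hom P Q → Set ℓ
  _≐_ {P} {Q} f g = ∀ (x : ∣ P ∣) → Poset._≈_ Q (app f x) (app g x)

  _⊑_ : {P Q : Obj ℓ} → Hom P Q → Hom P Q → Set ℓ
  _⊑_ {P} {Q} f g = ∀ (x : ∣ P ∣) → Poset._≤_ Q (app f x) (app g x)

  idP : {P : Obj ℓ} → Hom P P
  idP {P} = mkPosetHomo P P (λ x → x) (λ p → p)

  _∘P_ : {P Q R : Obj ℓ} → Hom Q R → Hom P Q → Hom P R
  _∘P_ {P} {Q} {R} g f =
    mkPosetHomo P R (λ x → app g (app f x))
      (λ p → PosetHomomorphism.mono g (PosetHomomorphism.mono f p))

  infixr 9 _∘P_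

  _+P_ : Obj ℓ → Obj ℓ → Obj ℓ
  P +P Q = PW.⊎-poset P Q

  infixr 5 _+P_

  inl : {P Q : Obj ℓ} → Hom P (P +P Q)
  inl {P} {Q} = mkPosetHomo P (P +P Q) inj₁ PW.inj₁

  inr : {P Q : Obj ℓ} → Hom Q (P +P Q)
  inr {P} {Q} = mkPosetHomo Q (P +P Q) inj₂ PW.inj₂

  [_,_]P : {P Q R : Obj ℓ} → Hom P R → Hom Q R → Hom (P +P Q) R
  [_,_]P {P} {Q} {R} f g = mkPosetHomo (P +P Q) R h h-mono
    where
      h : ∣ P +P Q ∣ → ∣ R ∣
      h (inj₁ x) = app f x
      h (inj₂ y) = app g y
      h-mono : ∀ {x y} → Poset._≤_ (P +P Q) x y → Poset._≤_ R (h x) (h y)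
      h-mono (PW.inj₁ p) = PosetHomomorphism.mono f p
      h-mono (PW.inj₂ p) = PosetHomomorphism.mono g p

  _⊎P_ : {P P' Q Q' : Obj ℓ} → Hom P P' → Hom Q Q' → Hom (P +P Q) (P' +P Q')
  f ⊎P g = [ inl ∘P f , inr ∘P g ]P

  infixr 6 _⊎P_

  assocP : {P Q R : Obj ℓ} → Hom (P +P (Q +P R)) ((P +P Q) +P R)
  assocP = [ inl ∘P inl , [ inl ∘P inr , inr ]P ]P

record Functor (ℓ : Level) : Set (suc ℓ) where
  field
    F₀ : Obj ℓ → Obj ℓ
    F₁ : {P Q : Obj ℓ} → Hom P Q → Hom (F₀ P) (F₀ Q)
    identity : {P : Obj ℓ} → F₁ (idP {P = P}) ≐ idP
    homomorphism : {P Q R : Obj ℓ} {f : Hom P Q} {g : Hom Q R} →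
                   F₁ (g ∘P f) ≐ (F₁ g ∘P F₁ f)
    F-resp-≐ : {P Q : Obj ℓ} {f g : Hom P Q} → f ≐ g → F₁ f ≐ F₁ g

LocallyOrderPreserving : {ℓ : Level} → Functor ℓ → Set (suc ℓ)
LocallyOrderPreserving {ℓ} H =
  {P Q : Obj ℓ} {f g : Hom P Q} → f ⊑ g → Functor.F₁ H f ⊑ Functor.F₁ H g

IsJoin : {ℓ : Level} (A : Obj ℓ) {I : Set ℓ} → (I → ∣ A ∣) → ∣ A ∣ → Set ℓ
IsJoin A {I} f s =
  (∀ (i : I) → Poset._≤_ A (f i) s) ×
  (∀ (u : ∣ A ∣) → (∀ (i : I) → Poset._≤_ A (f i) u) → Poset._≤_ A s u)

IsCompleteLattice : {ℓ : Level} → Obj ℓ → Set (suc ℓ)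
IsCompleteLattice {ℓ} A = (I : Set ℓ) (f : I → ∣ A ∣) → Σ[ s ∈ ∣ A ∣ ] IsJoin A f s

module _ {ℓ : Level} (H : Functor ℓ) where
  open Functor H

  FlatEq : Obj ℓ → Obj ℓ → Set ℓ
  FlatEq X A = Hom X (F₀ X +P A)

  IsSolution : {A X : Obj ℓ} (α : Hom (F₀ A) A) → FlatEq X A → Hom X A → Set ℓ
  IsSolution α e s = s ≐ ([ α , idP ]P ∘P (F₁ s ⊎P idP) ∘P e)

  IsLeastSolution : {A X : Obj ℓ} (α : Hom (F₀ A) A) → FlatEq X A → Hom X A → Set ℓ
  IsLeastSolution {A} {X} α e s =
    IsSolution α e s × ((t : Hom X A) → IsSolution α e t → s ⊑ t)

  _•_ : {X Y Z : Obj ℓ} → Hom Y Z → FlatEq X Y → FlatEq X Z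
  h • e = (idP ⊎P h) ∘P e

  can : {X Y : Obj ℓ} → Hom (F₀ X +P F₀ Y) (F₀ (X +P Y))
  can = [ F₁ inl , F₁ inr ]P

  -- f ⊕ e  (the implicit reassociation HX + (HY + A) ≅ (HX + HY) + A is made explicit)
  _⊕_ : {X Y A : Obj ℓ} → FlatEq Y A → FlatEq X Y → FlatEq (X +P Y) A
  f ⊕ e = (can ⊎P idP) ∘P assocP ∘P (idP ⊎P f) ∘P [ e , inr ]P

  Dagger : Obj ℓ → Set (suc ℓ)
  Dagger A = {X : Obj ℓ} → FlatEq X A → Hom X A

  record IsCompleteElgotAlgebra (A : Obj ℓ) (α : Hom (F₀ A) A) (_† : Dagger A) : Set (suc ℓ) where
    field
      solution : {X : Obj ℓ} (e : FlatEq X A) → IsSolution α e (e †)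
      functoriality : {X Y : Obj ℓ} (e : FlatEq X A) (f : FlatEq Y A) (h : Hom X Y) →
                      ((F₁ h ⊎P idP) ∘P e) ≐ (f ∘P h) → (e †) ≐ ((f †) ∘P h)
      compositionality : {X Y : Obj ℓ} (e : FlatEq X Y) (f : FlatEq Y A) →
                         (((f †) • e) †) ≐ ((f ⊕ e) † ∘P inl)

{-# OPTIONS --safe #-}
-- A solution of e : X → HX + A is a fixed point of the map
-- Φ e s = [α, id]·(Hs + id)·e, which is monotone on the complete lattice
-- Pos(X, A) because H is locally order-preserving; so by Knaster–Tarski
-- e† is its least fixed point. Functoriality is fixed-point fusion:
-- precomposition with h commutes with Φ and has a right adjoint (the
-- right Kan extension along h). For compositionality, a solution of f ⊕ e
-- is exactly a solution s of f on Y together with a solution of s • e on X,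
-- and by functoriality (f ⊕ e)† restricts to f† on Y.
module Submission where

open import Defs
open import Level using (Level)
open import Data.Product using (Σ-syntax; _×_; _,_; proj₁; proj₂)
open import Data.Sum using (inj₁; inj₂)
open import Function.Bundles using (_⇔_; mk⇔; Equivalence)
open import Relation.Binary.Bundles using (Poset)
open import Relation.Binary.Morphism.Bundles using (PosetHomomorphism; mkPosetHomo)
import Relation.Binary.Properties.Poset as PosetProperties
import Relation.Binary.Reasoning.PartialOrder as ≤-Reasoning

open PosetHomomorphism using (mono)
open Equivalence using (to; from)

module CompleteLattice {ℓ : Level} (P : Obj ℓ) (complete : IsCompleteLattice P) where
  open Poset P

  ⋁ : {I : Set ℓ} → (I → ∣ P ∣) → ∣ P ∣
  ⋁ f = proj₁ (complete _ f)

  ⋁-upper : {I : Set ℓ} (f : I → ∣ P ∣) (i : I) → f i ≤ ⋁ f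
  ⋁-upper f = proj₁ (proj₂ (complete _ f))

  ⋁-least : {I : Set ℓ} (f : I → ∣ P ∣) (u : ∣ P ∣) → (∀ i → f i ≤ u) → ⋁ f ≤ u
  ⋁-least f = proj₂ (proj₂ (complete _ f))

  ⋀ : {I : Set ℓ} → (I → ∣ P ∣) → ∣ P ∣
  ⋀ {I} f = ⋁ {I = Σ[ l ∈ ∣ P ∣ ] (∀ i → l ≤ f i)} proj₁

  ⋀-lower : {I : Set ℓ} (f : I → ∣ P ∣) (i : I) → ⋀ f ≤ f i
  ⋀-lower f i = ⋁-least proj₁ (f i) (λ (l , l≤f) → l≤f i)

  ⋀-greatest : {I : Set ℓ} (f : I → ∣ P ∣) (l : ∣ P ∣) → (∀ i → l ≤ f i) → l ≤ ⋀ f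
  ⋀-greatest f l l≤f = ⋁-upper proj₁ (l , l≤f)

module LeastFixedPoint {ℓ : Level} (P : Obj ℓ) (complete : IsCompleteLattice P)
  (F : ∣ P ∣ → ∣ P ∣) (F-mono : ∀ {x y} → Poset._≤_ P x y → Poset._≤_ P (F x) (F y)) where
  open Poset P
  open CompleteLattice P complete

  lfp : ∣ P ∣
  lfp = ⋀ {I = Σ[ x ∈ ∣ P ∣ ] F x ≤ x} proj₁

  lfp-least : ∀ x → F x ≤ x → lfp ≤ x
  lfp-least x Fx≤x = ⋀-lower proj₁ (x , Fx≤x)

  lfp-prefixed : F lfp ≤ lfp
  lfp-prefixed = ⋀-greatest proj₁ (F lfp)
    (λ (x , Fx≤x) → trans (F-mono (lfp-least x Fx≤x)) Fx≤x)

  lfp-fixed : lfp ≈ F lfp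
  lfp-fixed = antisym (lfp-least (F lfp) (F-mono lfp-prefixed)) lfp-prefixed

GaloisConnection : {ℓ : Level} (P Q : Obj ℓ) → (∣ P ∣ → ∣ Q ∣) → (∣ Q ∣ → ∣ P ∣) → Set ℓ
GaloisConnection P Q L R = ∀ p q → Poset._≤_ Q (L p) q ⇔ Poset._≤_ P p (R q)

module _ {ℓ : Level} (P Q : Obj ℓ)
  (P-complete : IsCompleteLattice P) (Q-complete : IsCompleteLattice Q)
  (F : ∣ P ∣ → ∣ P ∣) (G : ∣ Q ∣ → ∣ Q ∣)
  (F-mono : ∀ {x y} → Poset._≤_ P x y → Poset._≤_ P (F x) (F y))
  (G-mono : ∀ {x y} → Poset._≤_ Q x y → Poset._≤_ Q (G x) (G y)) where
  private
    module P = Poset P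
    module Q = Poset Q
    module μF = LeastFixedPoint P P-complete F F-mono
    module μG = LeastFixedPoint Q Q-complete G G-mono

  lfp-fusion : (L : ∣ P ∣ → ∣ Q ∣) (R : ∣ Q ∣ → ∣ P ∣) → GaloisConnection P Q L R →
               (∀ p → L (F p) Q.≈ G (L p)) → L μF.lfp Q.≈ μG.lfp
  lfp-fusion L R L⊣R LF≈GL = Q.antisym LμF≤μG μG≤LμF
    where
    open ≤-Reasoning Q

    L-mono : ∀ {p p′} → p P.≤ p′ → L p Q.≤ L p′
    L-mono {p} {p′} p≤p′ = from (L⊣R p (L p′)) (P.trans p≤p′ (to (L⊣R p′ (L p′)) Q.refl))

    LμF≤μG : L μF.lfp Q.≤ μG.lfp
    LμF≤μG = from (L⊣R μF.lfp μG.lfp) (μF.lfp-least (R μG.lfp) (to (L⊣R _ μG.lfp) LFRμG≤μG))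
      where
      LFRμG≤μG : L (F (R μG.lfp)) Q.≤ μG.lfp
      LFRμG≤μG = begin
        L (F (R μG.lfp))  ≈⟨ LF≈GL (R μG.lfp) ⟩
        G (L (R μG.lfp))  ≤⟨ G-mono (from (L⊣R (R μG.lfp) μG.lfp) P.refl) ⟩
        G μG.lfp          ≤⟨ μG.lfp-prefixed ⟩
        μG.lfp            ∎

    μG≤LμF : μG.lfp Q.≤ L μF.lfp
    μG≤LμF = μG.lfp-least (L μF.lfp) (begin
      G (L μF.lfp)  ≈⟨ LF≈GL μF.lfp ⟨
      L (F μF.lfp)  ≤⟨ L-mono μF.lfp-prefixed ⟩
      L μF.lfp      ∎)

module _ {ℓ : Level} where

  HomPoset : Obj ℓ → Obj ℓ → Obj ℓ
  HomPoset X A = record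
    { Carrier = Hom X A
    ; _≈_ = _≐_
    ; _≤_ = _⊑_
    ; isPartialOrder = record
      { isPreorder = record
        { isEquivalence = record
          { refl = λ _ → A.Eq.refl
          ; sym = λ f≐g x → A.Eq.sym (f≐g x)
          ; trans = λ f≐g g≐h x → A.Eq.trans (f≐g x) (g≐h x)
          }
        ; reflexive = λ f≐g x → A.reflexive (f≐g x)
        ; trans = λ f⊑g g⊑h x → A.trans (f⊑g x) (g⊑h x)
        }
      ; antisym = λ f⊑g g⊑f x → A.antisym (f⊑g x) (g⊑f x)
      }
    }
    where module A = Poset A

  HomPoset-complete : {X A : Obj ℓ} → IsCompleteLattice A → IsCompleteLattice (HomPoset X A)
  HomPoset-complete {X} {A} A-complete I fs =
    ⋁-pointwise , (λ i x → ⋁-upper _ i) , (λ u fs⊑u x → ⋁-least _ (app u x) (λ i → fs⊑u i x))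
    where
    open CompleteLattice A A-complete

    ⋁-pointwise : Hom X A
    ⋁-pointwise = mkPosetHomo X A (λ x → ⋁ (λ i → app (fs i) x))
      (λ x≤y → ⋁-least _ _ (λ i → Poset.trans A (mono (fs i) x≤y) (⋁-upper _ i)))

  module _ {X Y : Obj ℓ} (A : Obj ℓ) (A-complete : IsCompleteLattice A) (h : Hom X Y) where
    private
      module Y = Poset Y
      module A = Poset A
    open CompleteLattice A A-complete

    ran : Hom X A → Hom Y A
    ran t = mkPosetHomo Y A (λ y → ⋀ {I = Σ[ x ∈ ∣ X ∣ ] y Y.≤ app h x} (λ (x , _) → app t x))
      (λ y≤y′ → ⋀-greatest _ _ (λ (x , y′≤hx) → ⋀-lower _ (x , Y.trans y≤y′ y′≤hx)))

    precomposition⊣ran : GaloisConnection (HomPoset Y A) (HomPoset X A) (_∘P h) ran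
    precomposition⊣ran s t = mk⇔
      (λ sh⊑t y → ⋀-greatest _ _ (λ (x , y≤hx) → A.trans (mono s y≤hx) (sh⊑t x)))
      (λ s⊑rant x → A.trans (s⊑rant (app h x)) (⋀-lower _ (x , Y.refl)))

module LeastSolutions {ℓ : Level} (H : Functor ℓ) (H-lop : LocallyOrderPreserving H)
  {A : Obj ℓ} (α : Hom (Functor.F₀ H A) A) (A-complete : IsCompleteLattice A) where
  open Functor H
  private
    module A = Poset A

  plug : {X : Obj ℓ} → Hom X A → Hom (F₀ X +P A) A
  plug s = [ α , idP ]P ∘P (F₁ s ⊎P idP)

  Φ : {X : Obj ℓ} → FlatEq H X A → Hom X A → Hom X A
  Φ e s = plug s ∘P e

  plug-mono : {X : Obj ℓ} {s t : Hom X A} → s ⊑ t → plug s ⊑ plug t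
  plug-mono s⊑t (inj₁ u) = mono α (H-lop s⊑t u)
  plug-mono s⊑t (inj₂ a) = A.refl

  plug-∘ : {X Y : Obj ℓ} (s : Hom Y A) (h : Hom X Y) → plug (s ∘P h) ≐ (plug s ∘P (F₁ h ⊎P idP))
  plug-∘ s h (inj₁ u) = PosetHomomorphism.cong α (homomorphism u)
  plug-∘ s h (inj₂ a) = A.Eq.refl

  Φ-mono : {X : Obj ℓ} (e : FlatEq H X A) {s t : Hom X A} → s ⊑ t → Φ e s ⊑ Φ e t
  Φ-mono e s⊑t x = plug-mono s⊑t (app e x)

  Φ-cong : {X : Obj ℓ} (e : FlatEq H X A) {s t : Hom X A} → s ≐ t → Φ e s ≐ Φ e t
  Φ-cong {X} e = PosetProperties.mono⇒cong (HomPoset X A) {Φ e} (Φ-mono e)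

  Φ-natural : {X Y : Obj ℓ} {e : FlatEq H X A} {f : FlatEq H Y A} {h : Hom X Y} →
              ((F₁ h ⊎P idP) ∘P e) ≐ (f ∘P h) → ∀ s → (Φ f s ∘P h) ≐ Φ e (s ∘P h)
  Φ-natural {e = e} {h = h} square s x = A.Eq.trans
    (PosetHomomorphism.cong (plug s) (Poset.Eq.sym (F₀ _ +P A) (square x)))
    (A.Eq.sym (plug-∘ s h (app e x)))

  IsSolution-resp : {X : Obj ℓ} (e : FlatEq H X A) {s t : Hom X A} →
                    s ≐ t → IsSolution H α e s → IsSolution H α e t
  IsSolution-resp e {s} {t} s≐t s-sol x =
    A.Eq.trans (A.Eq.sym (s≐t x)) (A.Eq.trans (s-sol x) (Φ-cong e {s} {t} s≐t x))

  module _ {X Y : Obj ℓ} (e : FlatEq H X Y) where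

    Φ-•-cong : {t t′ : Hom Y A} → t ≐ t′ → ∀ s → Φ (_•_ H t e) s ≐ Φ (_•_ H t′ e) s
    Φ-•-cong t≐t′ s x with app e x
    ... | inj₁ u = A.Eq.refl
    ... | inj₂ y = t≐t′ y

    IsSolution-•-resp : {t t′ : Hom Y A} {s : Hom X A} → t ≐ t′ →
                        IsSolution H α (_•_ H t e) s → IsSolution H α (_•_ H t′ e) s
    IsSolution-•-resp {t} {t′} {s} t≐t′ s-sol x = A.Eq.trans (s-sol x) (Φ-•-cong {t} {t′} t≐t′ s x)

  module † {X : Obj ℓ} (e : FlatEq H X A) =
    LeastFixedPoint (HomPoset X A) (HomPoset-complete A-complete) (Φ e) (Φ-mono e)

  _† : Dagger H A
  e † = †.lfp e

  †-solution : {X : Obj ℓ} (e : FlatEq H X A) → IsSolution H α e (e †)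
  †-solution e = †.lfp-fixed e

  †-least : {X : Obj ℓ} (e : FlatEq H X A) → IsLeastSolution H α e (e †)
  †-least e = †-solution e , λ t t-sol → †.lfp-least e t (λ x → A.reflexive (A.Eq.sym (t-sol x)))

  †-functorial : {X Y : Obj ℓ} (e : FlatEq H X A) (f : FlatEq H Y A) (h : Hom X Y) →
                 ((F₁ h ⊎P idP) ∘P e) ≐ (f ∘P h) → (e †) ≐ ((f †) ∘P h)
  †-functorial {X} {Y} e f h square x = A.Eq.sym (f†∘h≐e† x)
    where
    f†∘h≐e† : ((f †) ∘P h) ≐ (e †)
    f†∘h≐e† = lfp-fusion (HomPoset Y A) (HomPoset X A)
      (HomPoset-complete A-complete) (HomPoset-complete A-complete) (Φ f) (Φ e) (Φ-mono f) (Φ-mono e)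
      (_∘P h) (ran A A-complete h) (precomposition⊣ran A A-complete h)
      (Φ-natural {e = e} {f} {h} square)

  module _ {X Y : Obj ℓ} (e : FlatEq H X Y) (f : FlatEq H Y A) where
    private
      f⊕e : FlatEq H (X +P Y) A
      f⊕e = _⊕_ H f e

    ⊕-inr-square : ((F₁ inr ⊎P idP) ∘P f) ≐ (f⊕e ∘P inr)
    ⊕-inr-square y with app f y
    ... | inj₁ u = Poset.Eq.refl (F₀ (X +P Y) +P A)
    ... | inj₂ a = Poset.Eq.refl (F₀ (X +P Y) +P A)

    Φ-⊕-inr : ∀ k → (Φ f⊕e k ∘P inr) ≐ Φ f (k ∘P inr)
    Φ-⊕-inr = Φ-natural {e = f} {f⊕e} {inr} ⊕-inr-square

    Φ-⊕-inl : ∀ k → (Φ f⊕e k ∘P inl) ≐ Φ (_•_ H (Φ f (k ∘P inr)) e) (k ∘P inl)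
    Φ-⊕-inl k x with app e x
    ... | inj₁ u = A.Eq.sym (plug-∘ k inl (inj₁ u))
    ... | inj₂ y = Φ-⊕-inr k y

    ⊕-solution⇔ : ∀ k → IsSolution H α f⊕e k ⇔
                  (IsSolution H α f (k ∘P inr) × IsSolution H α (_•_ H (k ∘P inr) e) (k ∘P inl))
    ⊕-solution⇔ k = mk⇔ split merge
      where
      k₁ : Hom X A
      k₁ = k ∘P inl

      k₂ : Hom Y A
      k₂ = k ∘P inr

      split : IsSolution H α f⊕e k →
              IsSolution H α f k₂ × IsSolution H α (_•_ H k₂ e) k₁
      split k-solves = k₂-solves , λ x → A.Eq.trans (k-solves (inj₁ x)) (A.Eq.trans (Φ-⊕-inl k x)
          (Φ-•-cong e {Φ f k₂} {k₂} (λ y → A.Eq.sym (k₂-solves y)) k₁ x))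
        where
        k₂-solves : IsSolution H α f k₂
        k₂-solves y = A.Eq.trans (k-solves (inj₂ y)) (Φ-⊕-inr k y)

      merge : IsSolution H α f k₂ × IsSolution H α (_•_ H k₂ e) k₁ →
              IsSolution H α f⊕e k
      merge (k₂-solves , k₁-solves) (inj₁ x) = A.Eq.trans (k₁-solves x)
        (A.Eq.trans (Φ-•-cong e {k₂} {Φ f k₂} k₂-solves k₁ x) (A.Eq.sym (Φ-⊕-inl k x)))
      merge (k₂-solves , k₁-solves) (inj₂ y) = A.Eq.trans (k₂-solves y) (A.Eq.sym (Φ-⊕-inr k y))

  †-compositional : {X Y : Obj ℓ} (e : FlatEq H X Y) (f : FlatEq H Y A) →
                    ((_•_ H (f †) e) †) ≐ ((_⊕_ H f e) † ∘P inl)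
  †-compositional {X} {Y} e f x = A.antisym
    (proj₂ (†-least f†•e) (g † ∘P inl) g†∘inl-solves x)
    (proj₂ (†-least g) k k-solves (inj₁ x))
    where
    g : FlatEq H (X +P Y) A
    g = _⊕_ H f e

    f†•e : FlatEq H X A
    f†•e = _•_ H (f †) e

    f†≐g†∘inr : (f †) ≐ ((g †) ∘P inr)
    f†≐g†∘inr = †-functorial f g inr (⊕-inr-square e f)

    g†∘inl-solves : IsSolution H α f†•e (g † ∘P inl)
    g†∘inl-solves = IsSolution-•-resp e {g † ∘P inr} {f †} (λ y → A.Eq.sym (f†≐g†∘inr y))
      (proj₂ (to (⊕-solution⇔ e f (g †)) (†-solution g)))

    k : Hom (X +P Y) A
    k = [ f†•e † , f † ]P

    k-solves : IsSolution H α g k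
    k-solves = from (⊕-solution⇔ e f k)
      ( IsSolution-resp f {f †} {k ∘P inr} (λ _ → A.Eq.refl) (†-solution f)
      , IsSolution-•-resp e {f †} {k ∘P inr} (λ _ → A.Eq.refl)
          (IsSolution-resp f†•e {f†•e †} {k ∘P inl} (λ _ → A.Eq.refl) (†-solution f†•e)))

proposition3p12 : {ℓ : Level} (H : Functor ℓ) → LocallyOrderPreserving H →
    (A : Obj ℓ) (α : Hom (Functor.F₀ H A) A) → IsCompleteLattice A →
    Σ[ _† ∈ Dagger H A ]
    (({X : Obj ℓ} (e : FlatEq H X A) → IsLeastSolution H α e (e †))
    × IsCompleteElgotAlgebra H A α _†)
proposition3p12 H H-lop A α A-complete = _† , †-least , record
  { solution = †-solution
  ; functoriality = †-functorial
  ; compositionality = †-compositional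
  }
  where open LeastSolutions H H-lop α A-complete
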